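{- Let $k>2$ be an integer and let $R_k=\{n : H(n)=k,\ 4\cdot 3^{k-2}<n\le 2\cdot 3^{k-1}\}$. Then $R_k$ consists exactly of the numbers of the form $2\cdot 3^{k-a}p$, where $p\in\widehat{P}$, $a=H(p)$ and $a\le k$.
   Context: Let $\varphi$ be Euler's totient function. The height function $H$ on positive integers is defined by $H(1)=0$ and $H(n)=H(\varphi(n))+1$ for $n\ge 2$. Let $\widehat{P}$ be the set of primes $p$ such that $p=2\cdot 3^{j-2}+1$ for some integer $j\ge 2$. -}

module Defs where

open import Data.Nat using (ℕ; zero; suc; _+_; _*_; _∸_; _^_; _≤_)
open import Data.Nat.Coprimality using (Coprime; coprime?)
open import Data.Nat.Primality using (Prime)
open import Data.List using (List; length; filter; map; upTo)
open import Data.Product using (_×_; ∃-syntax)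
open import Relation.Binary.PropositionalEquality using (_≡_)

φ : ℕ → ℕ
φ n = length (filter (λ m → coprime? m n) (map suc (upTo n)))

-- Height: H(1) = 0 and H(n) = H(φ n) + 1 for n ≥ 2.
-- Encoded as the graph relation  Height n k  ⇔  H(n) = k  (inductively, to
-- avoid a well-founded recursion on φ n < n).
data Height : ℕ → ℕ → Set where
  height-one : Height 1 0
  height-step : ∀ {n k} → 2 ≤ n → Height (φ n) k → Height n (suc k)

PHat : ℕ → Set
PHat p = Prime p × ∃[ j ] (2 ≤ j × p ≡ 2 * 3 ^ (j ∸ 2) + 1)

{-# OPTIONS --safe #-}

-- Write H₂ n = H(2n). By Shapiro's theorem H₂ − 1 is completely additive:
-- H₂(ab) + 1 = H₂ a + H₂ b, by strong induction on ab, using φ(pm) = p φ(m) for p ∣ m,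
-- φ(pm) = (p − 1) φ(m) for p ∤ m, and that φ(2b) is even for b ≥ 2.
-- With H₂ 2 = H₂ 3 = 2 this gives 3 n ≤ 3^(H₂ n), and 27 n ≤ 7 · 3^(H₂ n) when gcd(n, 6) = 1.
-- Hence an odd m with 2 · 3^(H₂ m) < 9 m is 3^s p with p prime: multiplying the second bound
-- for two factors prime to 6 gives 729 m ≤ 147 · 3^(H₂ m), contradicting it. For such a prime
-- p = 2r + 1 the first bound, applied to r, forces p = 2 · 3^(H₂ p − 2) + 1 ∈ P̂.
-- An n ∈ R_k is neither odd nor divisible by 4 (such n are at most 3^(k−1), resp. 4 · 3^(k−2)),
-- so n = 2m with m odd and 2 · 3^k < 9 m. Conversely H(2 · 3^s p) = s + H(p) for p ∈ P̂,
-- and 2 · 3^(k−a) p = 4 · 3^(k−2) + 2 · 3^(k−a) lies in the interval.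

module Submission where

open import Defs
open import Data.Nat using (ℕ; _+_; _*_; _∸_; _^_; _≤_; _<_)
open import Data.Product using (_×_; ∃-syntax)
open import Function.Bundles using (_⇔_)
open import Relation.Binary.PropositionalEquality using (_≡_)

import Algebra.Properties.CommutativeSemigroup as CommutativeSemigroupProperties
open import Data.List using ([]; _∷_; [_]; _++_; length; filter; map; upTo)
open import Data.List.Properties using (upTo-∷ʳ; map-++; length-++; filter-++)
open import Data.List.Relation.Unary.All using (_∷_)
open import Data.Nat using (zero; suc; z≤n; s≤s; NonZero; nonTrivial⇒≢1; nonTrivial⇒n>1; >-nonZero)
import Data.Nat.Coprimality as Coprimality
open import Data.Nat.Coprimality using (Coprime; coprime?; coprime-divisor)
open import Data.Nat.Divisibility
open import Data.Nat.Induction using (<-rec)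
open import Data.Nat.ListAction using (product)
open import Data.Nat.Primality
open import Data.Nat.Primality.Factorisation using (factorise)
open import Data.Nat.Properties
open import Data.Nat.Tactic.RingSolver using (solve-∀)
open import Data.Product using (_,_; proj₁; proj₂)
import Data.Product as Product
open import Data.Sum using (_⊎_; inj₁; inj₂; [_,_]′)
open import Function using (_∘_; id)
open import Function.Bundles using (mk⇔; Equivalence)
open import Level using (Level)
open import Relation.Binary.PropositionalEquality using (_≢_; refl; sym; trans; cong; cong₂; subst; module ≡-Reasoning)
open import Relation.Nullary using (Dec; yes; no; ¬_; contradiction; _×-dec_; ¬?; from-yes)
open import Relation.Unary using (Pred; Decidable)
open import Relation.Unary.Properties using (_∩?_; ∁?)

private
  module +-CS = CommutativeSemigroupProperties +-commutativeSemigroup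
  module *-CS = CommutativeSemigroupProperties *-commutativeSemigroup

  variable
    a ℓ : Level
    A B : Set a
    P Q : Pred ℕ ℓ

indicator : Dec A → ℕ
indicator (yes _) = 1
indicator (no _) = 0

indicator-cong : A ⇔ B → (a? : Dec A) (b? : Dec B) → indicator a? ≡ indicator b?
indicator-cong A⇔B (yes _) (yes _) = refl
indicator-cong A⇔B (yes a) (no ¬b) = contradiction (Equivalence.to A⇔B a) ¬b
indicator-cong A⇔B (no ¬a) (yes b) = contradiction (Equivalence.from A⇔B b) ¬a
indicator-cong A⇔B (no _) (no _) = refl

indicator-no : ¬ A → (a? : Dec A) → indicator a? ≡ 0
indicator-no ¬a (yes a) = contradiction a ¬a
indicator-no ¬a (no _) = refl

indicator-×-¬ : (a? : Dec A) (b? : Dec B) →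
  indicator a? ≡ indicator (a? ×-dec b?) + indicator (a? ×-dec ¬? b?)
indicator-×-¬ (yes _) (yes _) = refl
indicator-×-¬ (yes _) (no _) = refl
indicator-×-¬ (no _) _ = refl

count : Decidable P → ℕ → ℕ
count P? zero = 0
count P? (suc n) = count P? n + indicator (P? (suc n))

length-filter-upTo : (P? : Decidable P) (n : ℕ) →
  length (filter P? (map suc (upTo n))) ≡ count P? n
length-filter-upTo P? zero = refl
length-filter-upTo P? (suc n) = begin
  length (filter P? (map suc (upTo (suc n))))
    ≡⟨ cong (λ xs → length (filter P? (map suc xs))) (sym (upTo-∷ʳ n)) ⟩
  length (filter P? (map suc (upTo n ++ [ n ])))
    ≡⟨ cong (λ xs → length (filter P? xs)) (map-++ suc (upTo n) [ n ]) ⟩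
  length (filter P? (map suc (upTo n) ++ [ suc n ]))
    ≡⟨ cong length (filter-++ P? (map suc (upTo n)) [ suc n ]) ⟩
  length (filter P? (map suc (upTo n)) ++ filter P? [ suc n ])
    ≡⟨ length-++ (filter P? (map suc (upTo n))) ⟩
  length (filter P? (map suc (upTo n))) + length (filter P? [ suc n ])
    ≡⟨ cong₂ _+_ (length-filter-upTo P? n) (length-filter-singleton (suc n)) ⟩
  count P? n + indicator (P? (suc n)) ∎
  where
  open ≡-Reasoning
  length-filter-singleton : ∀ x → length (filter P? [ x ]) ≡ indicator (P? x)
  length-filter-singleton x with P? x
  ... | yes _ = refl
  ... | no _ = refl

count-cong : (P? : Decidable P) (Q? : Decidable Q) → (∀ x → P x ⇔ Q x) →
  ∀ n → count P? n ≡ count Q? n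
count-cong P? Q? P⇔Q zero = refl
count-cong P? Q? P⇔Q (suc n) =
  cong₂ _+_ (count-cong P? Q? P⇔Q n) (indicator-cong (P⇔Q (suc n)) (P? (suc n)) (Q? (suc n)))

count-+-period : (P? : Decidable P) (m : ℕ) → (∀ x → P (x + m) ⇔ P x) →
  ∀ a → count P? (a + m) ≡ count P? a + count P? m
count-+-period P? m period zero = refl
count-+-period P? m period (suc a) = begin
  count P? (a + m) + indicator (P? (suc a + m))
    ≡⟨ cong₂ _+_ (count-+-period P? m period a) (indicator-cong (period (suc a)) (P? _) (P? _)) ⟩
  count P? a + count P? m + indicator (P? (suc a))
    ≡⟨ +-CS.xy∙z≈xz∙y (count P? a) (count P? m) (indicator (P? (suc a))) ⟩
  count P? a + indicator (P? (suc a)) + count P? m ∎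
  where open ≡-Reasoning

count-*-period : (P? : Decidable P) (m : ℕ) → (∀ x → P (x + m) ⇔ P x) →
  ∀ k → count P? (k * m) ≡ k * count P? m
count-*-period P? m period zero = refl
count-*-period P? m period (suc k) = begin
  count P? (m + k * m)          ≡⟨ cong (count P?) (+-comm m (k * m)) ⟩
  count P? (k * m + m)          ≡⟨ count-+-period P? m period (k * m) ⟩
  count P? (k * m) + count P? m ≡⟨ cong (_+ count P? m) (count-*-period P? m period k) ⟩
  k * count P? m + count P? m   ≡⟨ +-comm (k * count P? m) _ ⟩
  count P? m + k * count P? m   ∎
  where open ≡-Reasoning

count-∩-∁ : (P? : Decidable P) (Q? : Decidable Q) →
  ∀ n → count P? n ≡ count (P? ∩? Q?) n + count (P? ∩? ∁? Q?) n
count-∩-∁ P? Q? zero = refl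
count-∩-∁ P? Q? (suc n) = trans
  (cong₂ _+_ (count-∩-∁ P? Q? n) (indicator-×-¬ (P? (suc n)) (Q? (suc n))))
  (+-CS.interchange (count (P? ∩? Q?) n) _ _ _)

count-multiples : (P? : Decidable P) (d : ℕ) .{{_ : NonZero d}} →
  ∀ m → count (P? ∩? (d ∣?_)) (m * d) ≡ count (λ y → P? (y * d)) m
count-multiples P? (suc q) zero = refl
count-multiples P? d@(suc q) (suc m) = begin
  count X (d + m * d)
    ≡⟨ cong (count X) (trans (+-comm d (m * d)) (+-suc (m * d) q)) ⟩
  count X (m * d + q) + indicator (X (suc (m * d + q)))
    ≡⟨ cong₂ _+_ (no-multiples-below q ≤-refl) last-is-multiple ⟩
  count X (m * d) + indicator (P? (suc m * d))
    ≡⟨ cong (_+ indicator (P? (suc m * d))) (count-multiples P? d m) ⟩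
  count (λ y → P? (y * d)) m + indicator (P? (suc m * d)) ∎
  where
  open ≡-Reasoning
  X = P? ∩? (d ∣?_)
  no-multiples-below : ∀ i → i ≤ q → count X (m * d + i) ≡ count X (m * d)
  no-multiples-below zero _ = cong (count X) (+-identityʳ (m * d))
  no-multiples-below (suc i) i<q = begin
    count X (m * d + suc i)
      ≡⟨ cong (count X) (+-suc (m * d) i) ⟩
    count X (m * d + i) + indicator (X (suc (m * d + i)))
      ≡⟨ cong₂ _+_ (no-multiples-below i (<⇒≤ i<q)) (indicator-no (d∤ ∘ proj₂) (X _)) ⟩
    count X (m * d) + 0
      ≡⟨ +-identityʳ _ ⟩
    count X (m * d) ∎
    where
    d∤ : ¬ d ∣ suc (m * d + i)
    d∤ d∣ = <⇒≱ (s≤s i<q) (∣⇒≤ (∣m+n∣m⇒∣n (subst (d ∣_) (sym (+-suc (m * d) i)) d∣) (n∣m*n m)))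
  last-is-multiple : indicator (X (suc (m * d + q))) ≡ indicator (P? (suc m * d))
  last-is-multiple rewrite sym (+-suc (m * d) q) | +-comm (m * d) d =
    indicator-cong (mk⇔ proj₁ (_, n∣m*n (suc m))) (X _) (P? _)

count-≤ : (P? : Decidable P) → ∀ n → count P? n ≤ n
count-≤ P? zero = z≤n
count-≤ P? (suc n) with P? (suc n)
... | yes _ = subst (_≤ suc n) (+-comm 1 (count P? n)) (s≤s (count-≤ P? n))
... | no _ = subst (_≤ suc n) (sym (+-identityʳ (count P? n))) (m≤n⇒m≤1+n (count-≤ P? n))

count-suc-reject : (P? : Decidable P) → ∀ {n} → ¬ P (suc n) → count P? (suc n) ≡ count P? n
count-suc-reject P? {n} ¬P = trans (cong (count P? n +_) (indicator-no ¬P (P? (suc n)))) (+-identityʳ _)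

count-positive : (P? : Decidable P) → P 1 → ∀ n → 1 ≤ n → 1 ≤ count P? n
count-positive P? P1 (suc zero) _ with P? 1
... | yes _ = ≤-refl
... | no ¬P1 = contradiction P1 ¬P1
count-positive P? P1 (suc (suc n)) _ = ≤-trans (count-positive P? P1 (suc n) (s≤s z≤n)) (m≤m+n _ _)

data Parity : ℕ → Set where
  even : ∀ t → Parity (2 * t)
  odd  : ∀ t → Parity (suc (2 * t))

parity : ∀ n → Parity n
parity zero = even 0
parity (suc n) with parity n
... | even t = odd t
... | odd t = subst Parity (*-suc 2 t) (even (suc t))

2∣2* : ∀ t → 2 ∣ 2 * t
2∣2* t = m∣m*n t

2∤1+2* : ∀ t → ¬ 2 ∣ suc (2 * t)
2∤1+2* t 2∣ = contradiction (∣1⇒≡1 (∣m+n∣m⇒∣n (subst (2 ∣_) (+-comm 1 (2 * t)) 2∣) (2∣2* t))) λ ()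

prime≢1 : ∀ {p} → Prime p → p ≢ 1
prime≢1 pr = nonTrivial⇒≢1 {{prime⇒nonTrivial pr}}

prime>1 : ∀ {p} → Prime p → 1 < p
prime>1 {p} pr = nonTrivial⇒n>1 p {{prime⇒nonTrivial pr}}

2∣prime⇒≡2 : ∀ {p} → Prime p → 2 ∣ p → p ≡ 2
2∣prime⇒≡2 pr 2∣p = [ (λ ()) , sym ]′ (prime⇒irreducible pr 2∣p)

prime∣2⇒≡2 : ∀ {p} → Prime p → p ∣ 2 → p ≡ 2
prime∣2⇒≡2 pr p∣2 = [ (λ p≡1 → contradiction p≡1 (prime≢1 pr)) , id ]′ (prime⇒irreducible prime[2] p∣2)

prime≡2⊎odd : ∀ {p} → Prime p → p ≡ 2 ⊎ ∃[ t ] p ≡ suc (2 * t)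
prime≡2⊎odd {p} pr with parity p
... | even t = inj₁ (2∣prime⇒≡2 pr (2∣2* t))
... | odd t = inj₂ (t , refl)

prime[1+2r]⇒1≤r : ∀ {r} → Prime (suc (2 * r)) → 1 ≤ r
prime[1+2r]⇒1≤r {zero} pr = contradiction refl (prime≢1 pr)
prime[1+2r]⇒1≤r {suc r} _ = s≤s z≤n

data PrimeOrProduct : ℕ → Set where
  isPrime : ∀ {n} → Prime n → PrimeOrProduct n
  isProduct : ∀ {p m} → Prime p → 2 ≤ m → PrimeOrProduct (p * m)

primeOrProduct : ∀ {n} → 2 ≤ n → PrimeOrProduct n
primeOrProduct {n} 2≤n with factorise n {{>-nonZero (≤-trans (s≤s z≤n) 2≤n)}}
... | record { factors = [] ; isFactorisation = n≡1 } = contradiction n≡1 (>⇒≢ 2≤n)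
... | record { factors = p ∷ ps ; isFactorisation = n≡p*Πps ; factorsPrime = pr ∷ _ }
  = subst PrimeOrProduct (sym n≡p*Πps) (split (product ps) (subst (2 ≤_) n≡p*Πps 2≤n))
  where
  split : ∀ m → 2 ≤ p * m → PrimeOrProduct (p * m)
  split zero 2≤p*0 = contradiction (subst (2 ≤_) (*-zeroʳ p) 2≤p*0) λ ()
  split (suc zero) _ = isPrime (subst Prime (sym (*-identityʳ p)) pr)
  split (suc (suc m)) _ = isProduct pr (s≤s (s≤s z≤n))

<-prime* : ∀ {p m} → Prime p → 1 ≤ m → m < p * m
<-prime* {p} {m} pr 1≤m = subst (m <_) (*-comm m p) (m<m*n m p {{>-nonZero 1≤m}} (prime>1 pr))

coprime-+ʳ⇔ : ∀ {x n} → Coprime (x + n) n ⇔ Coprime x n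
coprime-+ʳ⇔ {x} {n} = mk⇔
  (λ c {_} (d∣x , d∣n) → c (∣m∣n⇒∣m+n d∣x d∣n , d∣n))
  (λ c {d} (d∣x+n , d∣n) → c (∣m+n∣m⇒∣n (subst (d ∣_) (+-comm x n) d∣x+n) d∣n , d∣n))

coprime-*ʳ⇔ : ∀ {x m n} → Coprime x (m * n) ⇔ (Coprime x m × Coprime x n)
coprime-*ʳ⇔ {x} {m} {n} = mk⇔
  (λ c → (λ {_} (d∣x , d∣m) → c (d∣x , ∣m⇒∣m*n n d∣m)) , (λ {_} (d∣x , d∣n) → c (d∣x , ∣n⇒∣m*n m d∣n)))
  (λ (cm , cn) {_} (d∣x , d∣mn) → cn (d∣x , coprime-divisor (λ {_} (e∣d , e∣m) → cm (∣-trans e∣d d∣x , e∣m)) d∣mn))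

coprime-*ˡ⇔ : ∀ {x m n} → Coprime (m * n) x ⇔ (Coprime m x × Coprime n x)
coprime-*ˡ⇔ {x} {m} {n} = mk⇔ to from
  where
  to : Coprime (m * n) x → Coprime m x × Coprime n x
  to c = Product.map Coprimality.sym Coprimality.sym (Equivalence.to coprime-*ʳ⇔ (Coprimality.sym c))
  from : Coprime m x × Coprime n x → Coprime (m * n) x
  from (cm , cn) = Coprimality.sym (Equivalence.from coprime-*ʳ⇔ (Coprimality.sym cm , Coprimality.sym cn))

coprime-prime⇔∤ : ∀ {x p} → Prime p → Coprime x p ⇔ (¬ p ∣ x)
coprime-prime⇔∤ {x} {p} pr = mk⇔
  (λ c p∣x → prime≢1 pr (c (p∣x , ∣-refl)))
  (λ p∤x {_} (d∣x , d∣p) → [ id , (λ d≡p → contradiction (subst (_∣ x) d≡p d∣x) p∤x) ]′ (prime⇒irreducible pr d∣p))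

coprimeTo? : ∀ n → Decidable (λ x → Coprime x n)
coprimeTo? n x = coprime? x n

φ≡count : ∀ n → φ n ≡ count (coprimeTo? n) n
φ≡count n = length-filter-upTo (coprimeTo? n) n

coprime-prime*⇔ : ∀ {x p m} → Prime p → Coprime x (p * m) ⇔ (Coprime x m × ¬ p ∣ x)
coprime-prime*⇔ {x} {p} {m} pr = mk⇔ to from
  where
  to : Coprime x (p * m) → Coprime x m × ¬ p ∣ x
  to c = let (cp , cm) = Equivalence.to coprime-*ʳ⇔ c in cm , Equivalence.to (coprime-prime⇔∤ pr) cp
  from : Coprime x m × ¬ p ∣ x → Coprime x (p * m)
  from (cm , p∤x) = Equivalence.from coprime-*ʳ⇔ (Equivalence.from (coprime-prime⇔∤ pr) p∤x , cm)

φ-count-period : ∀ m k → count (coprimeTo? m) (k * m) ≡ k * φ m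
φ-count-period m k = trans (count-*-period (coprimeTo? m) m (λ _ → coprime-+ʳ⇔) k) (cong (k *_) (sym (φ≡count m)))

φ-*-prime-∣ : ∀ {p m} → Prime p → p ∣ m → φ (p * m) ≡ p * φ m
φ-*-prime-∣ {p} {m} pr p∣m = begin
  φ (p * m)                          ≡⟨ φ≡count (p * m) ⟩
  count (coprimeTo? (p * m)) (p * m) ≡⟨ count-cong (coprimeTo? (p * m)) (coprimeTo? m) coprime⇔ (p * m) ⟩
  count (coprimeTo? m) (p * m)       ≡⟨ φ-count-period m p ⟩
  p * φ m                            ∎
  where
  open ≡-Reasoning
  coprime⇔ : ∀ x → Coprime x (p * m) ⇔ Coprime x m
  coprime⇔ x = mk⇔ (proj₁ ∘ Equivalence.to (coprime-prime*⇔ pr))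
    (λ c → Equivalence.from (coprime-prime*⇔ pr) (c , λ p∣x → prime≢1 pr (c (p∣x , p∣m))))

φ-*-prime-∤ : ∀ {p m} → Prime p → ¬ p ∣ m → φ (p * m) ≡ (p ∸ 1) * φ m
φ-*-prime-∤ {p} {m} pr p∤m = begin
  φ (p * m)                 ≡⟨ m+n∸m≡n (φ m) (φ (p * m)) ⟨
  φ m + φ (p * m) ∸ φ m     ≡⟨ cong (_∸ φ m) split ⟩
  p * φ m ∸ φ m             ≡⟨ cong (p * φ m ∸_) (*-identityˡ (φ m)) ⟨
  p * φ m ∸ 1 * φ m         ≡⟨ *-distribʳ-∸ (φ m) p 1 ⟨
  (p ∸ 1) * φ m             ∎
  where
  open ≡-Reasoning
  C = coprimeTo? m
  multiples : count (C ∩? (p ∣?_)) (p * m) ≡ φ m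
  multiples = begin
    count (C ∩? (p ∣?_)) (p * m)        ≡⟨ cong (count (C ∩? (p ∣?_))) (*-comm p m) ⟩
    count (C ∩? (p ∣?_)) (m * p)        ≡⟨ count-multiples C p {{prime⇒nonZero pr}} m ⟩
    count (λ y → C (y * p)) m           ≡⟨ count-cong (λ y → C (y * p)) C coprime⇔ m ⟩
    count C m                           ≡⟨ φ≡count m ⟨
    φ m                                 ∎
    where
    coprime⇔ : ∀ y → Coprime (y * p) m ⇔ Coprime y m
    coprime⇔ y = mk⇔ (proj₁ ∘ Equivalence.to coprime-*ˡ⇔)
      (λ c → Equivalence.from coprime-*ˡ⇔ (c , Coprimality.sym (Equivalence.from (coprime-prime⇔∤ pr) p∤m)))
  non-multiples : count (C ∩? ∁? (p ∣?_)) (p * m) ≡ φ (p * m)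
  non-multiples = begin
    count (C ∩? ∁? (p ∣?_)) (p * m)     ≡⟨ count-cong (coprimeTo? (p * m)) (C ∩? ∁? (p ∣?_)) (λ _ → coprime-prime*⇔ pr) (p * m) ⟨
    count (coprimeTo? (p * m)) (p * m)  ≡⟨ φ≡count (p * m) ⟨
    φ (p * m)                           ∎
  split : φ m + φ (p * m) ≡ p * φ m
  split = begin
    φ m + φ (p * m)                     ≡⟨ cong₂ _+_ multiples non-multiples ⟨
    count (C ∩? (p ∣?_)) (p * m) + count (C ∩? ∁? (p ∣?_)) (p * m) ≡⟨ count-∩-∁ C (p ∣?_) (p * m) ⟨
    count C (p * m)                     ≡⟨ φ-count-period m p ⟩
    p * φ m                             ∎

φ-prime : ∀ {p} → Prime p → φ p ≡ p ∸ 1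
φ-prime {p} pr = begin
  φ p             ≡⟨ cong φ (*-identityʳ p) ⟨
  φ (p * 1)       ≡⟨ φ-*-prime-∤ pr (prime≢1 pr ∘ ∣1⇒≡1) ⟩
  (p ∸ 1) * 1     ≡⟨ *-identityʳ (p ∸ 1) ⟩
  p ∸ 1           ∎
  where open ≡-Reasoning

φ-positive : ∀ {n} → 1 ≤ n → 1 ≤ φ n
φ-positive {n} 1≤n = subst (1 ≤_) (sym (φ≡count n))
  (count-positive (coprimeTo? n) (λ (d∣1 , _) → ∣1⇒≡1 d∣1) n 1≤n)

φ-< : ∀ {n} → 2 ≤ n → φ n < n
φ-< {suc n} 2≤n = begin-strict
  φ (suc n)                      ≡⟨ φ≡count (suc n) ⟩
  count (coprimeTo? (suc n)) (suc n) ≡⟨ count-suc-reject (coprimeTo? (suc n)) (λ c → <⇒≢ 2≤n (sym (c (∣-refl , ∣-refl)))) ⟩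
  count (coprimeTo? (suc n)) n   ≤⟨ count-≤ (coprimeTo? (suc n)) n ⟩
  n                              <⟨ n<1+n n ⟩
  suc n                          ∎
  where open ≤-Reasoning

φ-even : ∀ n → 3 ≤ n → 2 ∣ φ n
φ-even = <-rec (λ n → 3 ≤ n → 2 ∣ φ n) step
  where
  step : ∀ n → (∀ {m} → m < n → 3 ≤ m → 2 ∣ φ m) → 3 ≤ n → 2 ∣ φ n
  step n rec 3≤n with primeOrProduct (<⇒≤ 3≤n)
  step n rec 3≤n | isPrime pr with prime≡2⊎odd pr
  ... | inj₁ refl = contradiction 3≤n λ { (s≤s (s≤s ())) }
  ... | inj₂ (t , refl) = subst (2 ∣_) (sym (φ-prime pr)) (2∣2* t)
  step .(p * m) rec 3≤n | isProduct {p} {m} pr 2≤m with p ∣? m | m≤n⇒m<n∨m≡n 2≤m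
  ... | yes p∣m | inj₁ 3≤m = subst (2 ∣_) (sym (φ-*-prime-∣ pr p∣m))
          (∣n⇒∣m*n p (rec (<-prime* pr (<⇒≤ 2≤m)) 3≤m))
  ... | yes p∣m | inj₂ refl = subst (2 ∣_) (sym (φ-*-prime-∣ pr p∣m))
          (∣m⇒∣m*n (φ m) (∣-reflexive (sym (prime∣2⇒≡2 pr p∣m))))
  ... | no p∤m | m>2⊎m≡2 with prime≡2⊎odd pr
  ...   | inj₂ (t , refl) = subst (2 ∣_) (sym (φ-*-prime-∤ pr p∤m)) (∣m⇒∣m*n (φ m) (2∣2* t))
  ...   | inj₁ refl = subst (2 ∣_) (sym (φ-*-prime-∤ pr p∤m)) (∣n⇒∣m*n 1 (rec (<-prime* pr (<⇒≤ 2≤m)) 3≤m))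
    where
    3≤m : 3 ≤ m
    3≤m = [ id , (λ { refl → contradiction ∣-refl p∤m }) ]′ m>2⊎m≡2

-- H computed with fuel; since φ n < n, fuel n suffices for n.
heightWithin : ℕ → ℕ → ℕ
heightWithin zero _ = 0
heightWithin (suc fuel) zero = 0
heightWithin (suc fuel) (suc zero) = 0
heightWithin (suc fuel) n@(suc (suc _)) = suc (heightWithin fuel (φ n))

Height-heightWithin : ∀ fuel n → 1 ≤ n → n ≤ fuel → Height n (heightWithin fuel n)
Height-heightWithin (suc fuel) (suc zero) _ _ = height-one
Height-heightWithin (suc fuel) n@(suc (suc _)) _ (s≤s n≤1+fuel) =
  height-step (s≤s (s≤s z≤n)) (Height-heightWithin fuel (φ n) (φ-positive {n} (s≤s z≤n))
    (≤-pred (≤-trans (φ-< {n} (s≤s (s≤s z≤n))) (s≤s n≤1+fuel))))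

-- opaque: otherwise unification unfolds height into evaluations of φ
opaque
  height : ℕ → ℕ
  height n = heightWithin n n

  Height-height : ∀ {n} → 1 ≤ n → Height n (height n)
  Height-height {n} 1≤n = Height-heightWithin n n 1≤n ≤-refl

Height-functional : ∀ {n a b} → Height n a → Height n b → a ≡ b
Height-functional height-one height-one = refl
Height-functional height-one (height-step (s≤s ()) _)
Height-functional (height-step (s≤s ()) _) height-one
Height-functional (height-step _ ha) (height-step _ hb) = cong suc (Height-functional ha hb)

Height⇒≥1 : ∀ {n k} → Height n k → 1 ≤ n
Height⇒≥1 height-one = s≤s z≤n
Height⇒≥1 (height-step 2≤n _) = <⇒≤ 2≤n

Height⇒height≡ : ∀ {n k} → Height n k → height n ≡ k
Height⇒height≡ h = Height-functional (Height-height (Height⇒≥1 h)) h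

height≡⇒Height : ∀ {n k} → 1 ≤ n → height n ≡ k → Height n k
height≡⇒Height 1≤n refl = Height-height 1≤n

height-φ : ∀ {n} → 2 ≤ n → height n ≡ suc (height (φ n))
height-φ 2≤n = Height⇒height≡ (height-step 2≤n (Height-height (φ-positive (<⇒≤ 2≤n))))

-- Complete additivity of H(2n) − 1

H₂ : ℕ → ℕ
H₂ n = height (2 * n)

H₂[1] : H₂ 1 ≡ 1
H₂[1] = Height⇒height≡ (height-step (s≤s (s≤s z≤n)) height-one)

H₂[2] : H₂ 2 ≡ 2
H₂[2] = Height⇒height≡ (height-step (s≤s (s≤s z≤n)) (height-step (s≤s (s≤s z≤n)) height-one))

H₂[3] : H₂ 3 ≡ 2
H₂[3] = Height⇒height≡ (height-step (s≤s (s≤s z≤n)) (height-step (s≤s (s≤s z≤n)) height-one))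

H₂-positive : ∀ {n} → 1 ≤ n → 1 ≤ H₂ n
H₂-positive {n} 1≤n = subst (1 ≤_) (sym (height-φ (*-monoʳ-≤ 2 1≤n))) (s≤s z≤n)

H₂-φ : ∀ {n} t → 1 ≤ n → φ (2 * n) ≡ 2 * t → H₂ n ≡ suc (H₂ t)
H₂-φ t 1≤n φ[2n]≡2t = trans (height-φ (*-monoʳ-≤ 2 1≤n)) (cong (suc ∘ height) φ[2n]≡2t)

φ-double-half : ∀ {n} → 2 ≤ n → ∃[ t ] (φ (2 * n) ≡ 2 * t × 1 ≤ t × t < n)
φ-double-half {n} 2≤n with φ-even (2 * n) (≤-trans (n≤1+n 3) (*-monoʳ-≤ 2 2≤n))
... | divides t φ[2n]≡t*2 = t , φ[2n]≡2t , 1≤t , t<n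
  where
  φ[2n]≡2t : φ (2 * n) ≡ 2 * t
  φ[2n]≡2t = trans φ[2n]≡t*2 (*-comm t 2)
  1≤t : 1 ≤ t
  1≤t = positive-half (subst (1 ≤_) φ[2n]≡2t (φ-positive {2 * n} (≤-trans (s≤s z≤n) (*-monoʳ-≤ 2 2≤n))))
    where
    positive-half : ∀ {t} → 1 ≤ 2 * t → 1 ≤ t
    positive-half {suc _} _ = s≤s z≤n
  t<n : t < n
  t<n = *-cancelˡ-< 2 t n (subst (_< 2 * n) φ[2n]≡2t (φ-< {2 * n} (≤-trans (s≤s (s≤s z≤n)) (*-monoʳ-≤ 2 2≤n))))

H₂-odd : ∀ {m} → 2 ≤ m → ¬ 2 ∣ m → H₂ m ≡ height m
H₂-odd {m} 2≤m 2∤m = begin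
  height (2 * m)        ≡⟨ height-φ (*-monoʳ-≤ 2 (<⇒≤ 2≤m)) ⟩
  suc (height (φ (2 * m))) ≡⟨ cong (suc ∘ height) (trans (φ-*-prime-∤ prime[2] 2∤m) (*-identityˡ (φ m))) ⟩
  suc (height (φ m))    ≡⟨ height-φ 2≤m ⟨
  height m              ∎
  where open ≡-Reasoning

H₂-oddPrime : ∀ {r} → Prime (suc (2 * r)) → H₂ (suc (2 * r)) ≡ suc (H₂ r)
H₂-oddPrime {r} pr = H₂-φ r (s≤s z≤n) (begin
  φ (2 * p)       ≡⟨ cong φ (*-comm 2 p) ⟩
  φ (p * 2)       ≡⟨ φ-*-prime-∤ pr (λ p∣2 → 2∤1+2* r (∣-reflexive (sym (prime∣2⇒≡2 pr p∣2)))) ⟩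
  2 * r * 1       ≡⟨ *-identityʳ (2 * r) ⟩
  2 * r           ∎)
  where
  open ≡-Reasoning
  p = suc (2 * r)

H₂-Additive : ℕ → ℕ → Set
H₂-Additive a b = suc (H₂ (a * b)) ≡ H₂ a + H₂ b

H₂-AdditiveBelow : ℕ → Set
H₂-AdditiveBelow N = ∀ {a b} → 1 ≤ a → 1 ≤ b → a * b < N → H₂-Additive a b

*-mono-≤-< : ∀ {u p t b} → 1 ≤ u → u ≤ p → t < b → u * t < p * b
*-mono-≤-< {u} {p} {t} {b} 1≤u u≤p t<b = <-≤-trans (*-monoʳ-< u {{>-nonZero 1≤u}} t<b) (*-monoˡ-≤ b u≤p)

H₂-additive-prime-∣ : ∀ {p b} → Prime p → 2 ≤ b → p ∣ 2 * b → H₂-AdditiveBelow (p * b) → H₂-Additive p b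
H₂-additive-prime-∣ {p} {b} pr 2≤b p∣2b additive with φ-double-half 2≤b
... | t , φ[2b]≡2t , 1≤t , t<b = begin
  suc (H₂ (p * b))      ≡⟨ cong suc (H₂-φ (p * t) 1≤pb φ[2pb]≡2pt) ⟩
  suc (suc (H₂ (p * t))) ≡⟨ cong suc (additive 1≤p 1≤t (*-monoʳ-< p {{prime⇒nonZero pr}} t<b)) ⟩
  suc (H₂ p + H₂ t)     ≡⟨ +-suc (H₂ p) (H₂ t) ⟨
  H₂ p + suc (H₂ t)     ≡⟨ cong (H₂ p +_) (H₂-φ t (<⇒≤ 2≤b) φ[2b]≡2t) ⟨
  H₂ p + H₂ b           ∎
  where
  open ≡-Reasoning
  1≤p = <⇒≤ (prime>1 pr)
  1≤pb = ≤-trans 1≤p (m≤m*n p b {{>-nonZero (<⇒≤ 2≤b)}})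
  φ[2pb]≡2pt : φ (2 * (p * b)) ≡ 2 * (p * t)
  φ[2pb]≡2pt = begin
    φ (2 * (p * b))  ≡⟨ cong φ (*-CS.x∙yz≈y∙xz 2 p b) ⟩
    φ (p * (2 * b))  ≡⟨ φ-*-prime-∣ pr p∣2b ⟩
    p * φ (2 * b)    ≡⟨ cong (p *_) φ[2b]≡2t ⟩
    p * (2 * t)      ≡⟨ *-CS.x∙yz≈y∙xz p 2 t ⟩
    2 * (p * t)      ∎
H₂-additive-oddPrime-∤ : ∀ {r b} → Prime (suc (2 * r)) → 2 ≤ b → ¬ suc (2 * r) ∣ 2 * b →
  H₂-AdditiveBelow (suc (2 * r) * b) → H₂-Additive (suc (2 * r)) b
H₂-additive-oddPrime-∤ {r} {b} pr 2≤b p∤2b additive with φ-double-half 2≤b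
... | t , φ[2b]≡2t , 1≤t , t<b = begin
  suc (H₂ (p * b))               ≡⟨ cong suc (H₂-φ (r * (2 * t)) 1≤pb φ[2pb]≡2r2t) ⟩
  suc (suc (H₂ (r * (2 * t))))   ≡⟨ cong suc (additive 1≤r 1≤2t r2t<pb) ⟩
  suc (H₂ r + H₂ (2 * t))        ≡⟨ cong₂ _+_ (sym (H₂-oddPrime {r} pr)) H₂[2t]≡H₂b ⟩
  H₂ p + H₂ b                    ∎
  where
  open ≡-Reasoning
  p = suc (2 * r)
  1≤r = prime[1+2r]⇒1≤r pr
  1≤2t = ≤-trans 1≤t (m≤m+n t _)
  1≤pb = ≤-trans (s≤s z≤n) (m≤m*n p b {{>-nonZero (<⇒≤ 2≤b)}})
  r2t<pb : r * (2 * t) < p * b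
  r2t<pb = subst (_< p * b) (trans (*-assoc 2 r t) (*-CS.x∙yz≈y∙xz 2 r t))
    (*-mono-≤-< (≤-trans 1≤r (m≤m+n r _)) (n≤1+n (2 * r)) t<b)
  2t<pb : 2 * t < p * b
  2t<pb = *-mono-≤-< (s≤s z≤n) (prime>1 pr) t<b
  H₂[2t]≡H₂b : H₂ (2 * t) ≡ H₂ b
  H₂[2t]≡H₂b = begin
    H₂ (2 * t)   ≡⟨ suc-injective (trans (additive {2} {t} (s≤s z≤n) 1≤t 2t<pb) (cong (_+ H₂ t) H₂[2])) ⟩
    suc (H₂ t)   ≡⟨ H₂-φ t (<⇒≤ 2≤b) φ[2b]≡2t ⟨
    H₂ b         ∎
  φ[2pb]≡2r2t : φ (2 * (p * b)) ≡ 2 * (r * (2 * t))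
  φ[2pb]≡2r2t = begin
    φ (2 * (p * b))    ≡⟨ cong φ (*-CS.x∙yz≈y∙xz 2 p b) ⟩
    φ (p * (2 * b))    ≡⟨ φ-*-prime-∤ pr p∤2b ⟩
    2 * r * φ (2 * b)  ≡⟨ cong (2 * r *_) φ[2b]≡2t ⟩
    2 * r * (2 * t)    ≡⟨ *-assoc 2 r (2 * t) ⟩
    2 * (r * (2 * t))  ∎

H₂-additive-prime : ∀ {p b} → Prime p → 2 ≤ b → H₂-AdditiveBelow (p * b) → H₂-Additive p b
H₂-additive-prime {p} {b} pr 2≤b additive with p ∣? 2 * b | prime≡2⊎odd pr
... | yes p∣2b | _ = H₂-additive-prime-∣ pr 2≤b p∣2b additive
... | no p∤2b | inj₁ refl = contradiction (2∣2* b) p∤2b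
... | no p∤2b | inj₂ (r , refl) = H₂-additive-oddPrime-∤ {r} pr 2≤b p∤2b additive

H₂-additive-≥2 : ∀ {a b} → 2 ≤ a → 2 ≤ b → H₂-AdditiveBelow (a * b) → H₂-Additive a b
H₂-additive-≥2 {a} {b} 2≤a 2≤b additive with primeOrProduct 2≤a
... | isPrime pr = H₂-additive-prime pr 2≤b additive
... | isProduct {p} {a′} pr 2≤a′ = suc-injective (begin
  suc (suc (H₂ (p * a′ * b)))    ≡⟨ cong (suc ∘ suc ∘ H₂) (*-assoc p a′ b) ⟩
  suc (suc (H₂ (p * (a′ * b))))  ≡⟨ cong suc (H₂-additive-prime pr 2≤a′b additive′) ⟩
  suc (H₂ p + H₂ (a′ * b))       ≡⟨ +-suc (H₂ p) _ ⟨
  H₂ p + suc (H₂ (a′ * b))       ≡⟨ cong (H₂ p +_) (additive 1≤a′ (<⇒≤ 2≤b) a′b<pa′b) ⟩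
  H₂ p + (H₂ a′ + H₂ b)          ≡⟨ +-assoc (H₂ p) _ _ ⟨
  H₂ p + H₂ a′ + H₂ b            ≡⟨ cong (_+ H₂ b) (additive 1≤p 1≤a′ pa′<pa′b) ⟨
  suc (H₂ (p * a′)) + H₂ b       ∎)
  where
  open ≡-Reasoning
  1≤p = <⇒≤ (prime>1 pr)
  1≤a′ = <⇒≤ 2≤a′
  additive′ : H₂-AdditiveBelow (p * (a′ * b))
  additive′ {x} {y} 1≤x 1≤y xy< = additive 1≤x 1≤y (subst (x * y <_) (sym (*-assoc p a′ b)) xy<)
  2≤a′b : 2 ≤ a′ * b
  2≤a′b = ≤-trans 2≤a′ (m≤m*n a′ b {{>-nonZero (<⇒≤ 2≤b)}})
  a′b<pa′b : a′ * b < p * a′ * b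
  a′b<pa′b = subst (a′ * b <_) (sym (*-assoc p a′ b)) (<-prime* pr (<⇒≤ 2≤a′b))
  pa′<pa′b : p * a′ < p * a′ * b
  pa′<pa′b = m<m*n (p * a′) b {{>-nonZero (≤-trans 1≤a′ (m≤n*m a′ p {{prime⇒nonZero pr}}))}} 2≤b

H₂-additive-step : ∀ {a b} → 1 ≤ a → 1 ≤ b → H₂-AdditiveBelow (a * b) → H₂-Additive a b
H₂-additive-step {suc zero} {b} _ _ _ = begin
  suc (H₂ (b + 0))  ≡⟨ cong (suc ∘ H₂) (+-identityʳ b) ⟩
  suc (H₂ b)        ≡⟨ cong (_+ H₂ b) H₂[1] ⟨
  H₂ 1 + H₂ b       ∎
  where open ≡-Reasoning
H₂-additive-step {a} {suc zero} _ _ _ = begin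
  suc (H₂ (a * 1))  ≡⟨ cong (suc ∘ H₂) (*-identityʳ a) ⟩
  suc (H₂ a)        ≡⟨ +-comm 1 (H₂ a) ⟩
  H₂ a + 1          ≡⟨ cong (H₂ a +_) H₂[1] ⟨
  H₂ a + H₂ 1       ∎
  where open ≡-Reasoning
H₂-additive-step {suc (suc _)} {suc (suc _)} _ _ = H₂-additive-≥2 (s≤s (s≤s z≤n)) (s≤s (s≤s z≤n))

H₂-additive : ∀ {a b} → 1 ≤ a → 1 ≤ b → H₂-Additive a b
H₂-additive 1≤a 1≤b = <-rec AdditiveAt step _ 1≤a 1≤b refl
  where
  AdditiveAt : ℕ → Set
  AdditiveAt N = ∀ {a b} → 1 ≤ a → 1 ≤ b → a * b ≡ N → H₂-Additive a b
  step : ∀ N → (∀ {M} → M < N → AdditiveAt M) → AdditiveAt N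
  step N rec 1≤a 1≤b refl = H₂-additive-step 1≤a 1≤b (λ 1≤x 1≤y xy<N → rec xy<N 1≤x 1≤y refl)

-- Bounds on n in terms of H(2n)

H₂-2* : ∀ {x} → 1 ≤ x → H₂ (2 * x) ≡ suc (H₂ x)
H₂-2* {x} 1≤x = suc-injective (trans (H₂-additive {2} (s≤s z≤n) 1≤x) (cong (_+ H₂ x) H₂[2]))

H₂-3* : ∀ {x} → 1 ≤ x → H₂ (3 * x) ≡ suc (H₂ x)
H₂-3* {x} 1≤x = suc-injective (trans (H₂-additive {3} (s≤s z≤n) 1≤x) (cong (_+ H₂ x) H₂[3]))

1≤3^ : ∀ s → 1 ≤ 3 ^ s
1≤3^ s = m^n>0 3 s

H₂-3^ : ∀ s → H₂ (3 ^ s) ≡ suc s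
H₂-3^ zero = H₂[1]
H₂-3^ (suc s) = trans (H₂-3* (1≤3^ s)) (cong suc (H₂-3^ s))

3^H₂-* : ∀ {a b} → 1 ≤ a → 1 ≤ b → 3 ^ H₂ a * 3 ^ H₂ b ≡ 3 * 3 ^ H₂ (a * b)
3^H₂-* {a} {b} 1≤a 1≤b = trans (sym (^-distribˡ-+-* 3 (H₂ a) (H₂ b))) (cong (3 ^_) (sym (H₂-additive 1≤a 1≤b)))

bound-product : ∀ {c d a b} → 1 ≤ a → 1 ≤ b →
  c * a ≤ d * 3 ^ H₂ a → c * b ≤ d * 3 ^ H₂ b → c * c * (a * b) ≤ 3 * (d * d) * 3 ^ H₂ (a * b)
bound-product {c} {d} {a} {b} 1≤a 1≤b ca≤ cb≤ = begin
  c * c * (a * b)                  ≡⟨ *-CS.interchange c c a b ⟩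
  (c * a) * (c * b)                ≤⟨ *-mono-≤ ca≤ cb≤ ⟩
  (d * 3 ^ H₂ a) * (d * 3 ^ H₂ b)  ≡⟨ *-CS.interchange d (3 ^ H₂ a) d (3 ^ H₂ b) ⟩
  d * d * (3 ^ H₂ a * 3 ^ H₂ b)    ≡⟨ cong (d * d *_) (3^H₂-* 1≤a 1≤b) ⟩
  d * d * (3 * 3 ^ H₂ (a * b))     ≡⟨ *-CS.x∙yz≈y∙xz (d * d) 3 (3 ^ H₂ (a * b)) ⟩
  3 * (d * d * 3 ^ H₂ (a * b))     ≡⟨ *-assoc 3 (d * d) _ ⟨
  3 * (d * d) * 3 ^ H₂ (a * b)     ∎
  where open ≤-Reasoning

bound-product′ : ∀ {c d a b} → 1 ≤ c → 3 * d ≤ c → 1 ≤ a → 1 ≤ b →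
  c * a ≤ d * 3 ^ H₂ a → c * b ≤ d * 3 ^ H₂ b → c * (a * b) ≤ d * 3 ^ H₂ (a * b)
bound-product′ {c} {d} {a} {b} 1≤c 3d≤c 1≤a 1≤b ca≤ cb≤ = *-cancelˡ-≤ c {{>-nonZero 1≤c}} (begin
  c * (c * (a * b))                ≡⟨ *-assoc c c (a * b) ⟨
  c * c * (a * b)                  ≤⟨ bound-product {c} {d} 1≤a 1≤b ca≤ cb≤ ⟩
  3 * (d * d) * 3 ^ H₂ (a * b)     ≡⟨ cong (_* 3 ^ H₂ (a * b)) (*-assoc 3 d d) ⟨
  3 * d * d * 3 ^ H₂ (a * b)       ≤⟨ *-monoˡ-≤ (3 ^ H₂ (a * b)) (*-monoˡ-≤ d 3d≤c) ⟩
  c * d * 3 ^ H₂ (a * b)           ≡⟨ *-assoc c d _ ⟩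
  c * (d * 3 ^ H₂ (a * b))         ∎)
  where open ≤-Reasoning

3*n≤3^H₂ : ∀ n → 1 ≤ n → 3 * n ≤ 3 ^ H₂ n
3*n≤3^H₂ = <-rec (λ n → 1 ≤ n → 3 * n ≤ 3 ^ H₂ n) step
  where
  step : ∀ n → (∀ {m} → m < n → 1 ≤ m → 3 * m ≤ 3 ^ H₂ m) → 1 ≤ n → 3 * n ≤ 3 ^ H₂ n
  step n rec 1≤n with m≤n⇒m<n∨m≡n 1≤n
  ... | inj₂ refl = subst (λ h → 3 ≤ 3 ^ h) (sym H₂[1]) ≤-refl
  ... | inj₁ 2≤n with primeOrProduct 2≤n
  ...   | isProduct {p} {m} pr 2≤m = drop1* (bound-product′ {3} {1} (s≤s z≤n) ≤-refl 1≤p 1≤m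
            (add1* (rec (m<m*n p m {{prime⇒nonZero pr}} 2≤m) 1≤p))
            (add1* (rec (<-prime* pr 1≤m) 1≤m)))
    where
    1≤p = <⇒≤ (prime>1 pr)
    1≤m = <⇒≤ 2≤m
    add1* : ∀ {x X} → x ≤ X → x ≤ 1 * X
    add1* = subst (_ ≤_) (sym (*-identityˡ _))
    drop1* : ∀ {x X} → x ≤ 1 * X → x ≤ X
    drop1* = subst (_ ≤_) (*-identityˡ _)
  ...   | isPrime pr with prime≡2⊎odd pr
  ...     | inj₁ refl = subst (λ h → 6 ≤ 3 ^ h) (sym H₂[2]) (m≤m+n 6 3)
  ...     | inj₂ (r , refl) = subst (λ h → 3 * suc (2 * r) ≤ 3 ^ h) (sym (H₂-oddPrime {r} pr))
              (odd-bound (rec (s≤s (m≤m+n r _)) 1≤r) (^-monoʳ-≤ 3 (H₂-positive 1≤r)))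
    where
    1≤r = prime[1+2r]⇒1≤r pr
    odd-bound : ∀ {X} → 3 * r ≤ X → 3 ≤ X → 3 * suc (2 * r) ≤ 3 * X
    odd-bound {X} 3r≤X 3≤X = begin
      3 * suc (2 * r)   ≡⟨ trans (*-suc 3 (2 * r)) (cong (3 +_) (*-CS.x∙yz≈y∙xz 3 2 r)) ⟩
      3 + 2 * (3 * r)   ≤⟨ +-mono-≤ 3≤X (*-monoʳ-≤ 2 3r≤X) ⟩
      X + 2 * X         ≡⟨⟩
      3 * X             ∎
      where open ≤-Reasoning

6≤3^⇒9≤3^ : ∀ e → 6 ≤ 3 ^ e → 9 ≤ 3 ^ e
6≤3^⇒9≤3^ zero (s≤s ())
6≤3^⇒9≤3^ (suc zero) (s≤s (s≤s (s≤s ())))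
6≤3^⇒9≤3^ (suc (suc e)) _ = subst (9 ≤_) (*-assoc 3 3 (3 ^ e)) (*-monoʳ-≤ 9 (1≤3^ e))

27*[1+2r]≤7*[3*X] : ∀ {r X} → 3 * r ≤ X → 9 ≤ X → 27 * suc (2 * r) ≤ 7 * (3 * X)
27*[1+2r]≤7*[3*X] {r} {X} 3r≤X 9≤X = begin
  27 * suc (2 * r)   ≡⟨ expand r ⟩
  27 + 18 * (3 * r)  ≤⟨ +-mono-≤ (*-monoʳ-≤ 3 9≤X) (*-monoʳ-≤ 18 3r≤X) ⟩
  3 * X + 18 * X     ≡⟨ collect X ⟩
  7 * (3 * X)        ∎
  where
  open ≤-Reasoning
  expand : ∀ r → 27 * suc (2 * r) ≡ 27 + 18 * (3 * r)
  expand = solve-∀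
  collect : ∀ X → 3 * X + 18 * X ≡ 7 * (3 * X)
  collect = solve-∀

27*n≤7*3^H₂ : ∀ n → 2 ≤ n → ¬ 2 ∣ n → ¬ 3 ∣ n → 27 * n ≤ 7 * 3 ^ H₂ n
27*n≤7*3^H₂ = <-rec (λ n → 2 ≤ n → ¬ 2 ∣ n → ¬ 3 ∣ n → 27 * n ≤ 7 * 3 ^ H₂ n) step
  where
  step : ∀ n → (∀ {m} → m < n → 2 ≤ m → ¬ 2 ∣ m → ¬ 3 ∣ m → 27 * m ≤ 7 * 3 ^ H₂ m) →
         2 ≤ n → ¬ 2 ∣ n → ¬ 3 ∣ n → 27 * n ≤ 7 * 3 ^ H₂ n
  step n rec 2≤n 2∤n 3∤n with primeOrProduct 2≤n
  ... | isProduct {p} {m} pr 2≤m = bound-product′ {27} {7} (s≤s z≤n) (m≤m+n 21 6)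
          1≤p (<⇒≤ 2≤m)
          (rec (m<m*n p m {{prime⇒nonZero pr}} 2≤m) (prime>1 pr) (2∤n ∘ ∣m⇒∣m*n m) (3∤n ∘ ∣m⇒∣m*n m))
          (rec (<-prime* pr (<⇒≤ 2≤m)) 2≤m (2∤n ∘ ∣n⇒∣m*n p) (3∤n ∘ ∣n⇒∣m*n p))
    where 1≤p = <⇒≤ (prime>1 pr)
  ... | isPrime pr with prime≡2⊎odd pr
  ...   | inj₁ refl = contradiction ∣-refl 2∤n
  ...   | inj₂ (zero , refl) = contradiction (prime[1+2r]⇒1≤r {0} pr) λ ()
  ...   | inj₂ (suc zero , refl) = contradiction ∣-refl 3∤n
  ...   | inj₂ (r@(suc (suc _)) , refl) = subst (λ h → 27 * suc (2 * r) ≤ 7 * 3 ^ h) (sym (H₂-oddPrime {r} pr))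
            (27*[1+2r]≤7*[3*X] {r} 3r≤3^H₂r (6≤3^⇒9≤3^ (H₂ r) (≤-trans (*-monoʳ-≤ 3 (s≤s (s≤s z≤n))) 3r≤3^H₂r)))
    where
    3r≤3^H₂r = 3*n≤3^H₂ r (s≤s z≤n)

-- Near-extremal odd numbers

-- Since 3 m ≤ 3 ^ H₂ m, this says that m exceeds two thirds of its largest possible value 3 ^ (H₂ m ∸ 1).
NearExtremal : ℕ → Set
NearExtremal m = 2 * 3 ^ H₂ m < 9 * m

PHat-3 : PHat 3
PHat-3 = from-yes (prime? 3) , 2 , ≤-refl , refl

2*[9*Y]<9*[1+2r]⇒Y≤r : ∀ {Y r} → 2 * (3 * (3 * Y)) < 9 * suc (2 * r) → Y ≤ r
2*[9*Y]<9*[1+2r]⇒Y≤r {Y} {r} 18Y<9+18r = ≤-pred (*-cancelˡ-< 18 Y (suc r) (begin-strict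
  18 * Y             ≡⟨ *-assoc 2 9 Y ⟩
  2 * (9 * Y)        ≡⟨ cong (2 *_) (*-assoc 3 3 Y) ⟩
  2 * (3 * (3 * Y))  <⟨ 18Y<9+18r ⟩
  9 * suc (2 * r)    ≡⟨ expand r ⟩
  9 + 18 * r         <⟨ +-monoˡ-< (18 * r) {9} {18} (m<m+n 9 (s≤s z≤n)) ⟩
  18 + 18 * r        ≡⟨ *-suc 18 r ⟨
  18 * suc r         ∎))
  where
  open ≤-Reasoning
  expand : ∀ r → 9 * suc (2 * r) ≡ 9 + 18 * r
  expand = solve-∀

near-extremal-prime : ∀ {p} → Prime p → ¬ 2 ∣ p → NearExtremal p → PHat p
near-extremal-prime pr 2∤p near with prime≡2⊎odd pr
... | inj₁ refl = contradiction ∣-refl 2∤p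
... | inj₂ (r , refl) with H₂ r in H₂r≡ | H₂-positive {r} (prime[1+2r]⇒1≤r {r} pr)
...   | zero | ()
...   | suc e | _ = pr , suc (suc e) , s≤s (s≤s z≤n) , trans (+-comm 1 (2 * r)) (cong (λ x → 2 * x + 1) r≡3^e)
  where
  r≤3^e : r ≤ 3 ^ e
  r≤3^e = *-cancelˡ-≤ 3 (subst (λ h → 3 * r ≤ 3 ^ h) H₂r≡ (3*n≤3^H₂ r (prime[1+2r]⇒1≤r pr)))
  3^e≤r : 3 ^ e ≤ r
  3^e≤r = 2*[9*Y]<9*[1+2r]⇒Y≤r (subst (λ h → 2 * 3 ^ h < 9 * suc (2 * r)) (trans (H₂-oddPrime {r} pr) (cong suc H₂r≡)) near)
  r≡3^e : r ≡ 3 ^ e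
  r≡3^e = ≤-antisym r≤3^e 3^e≤r

near-extremal-composite : ∀ {p m} → Prime p → 2 ≤ m → ¬ 2 ∣ p * m → ¬ 3 ∣ p * m →
  ¬ NearExtremal (p * m)
near-extremal-composite {p} {m} pr 2≤m 2∤n 3∤n near = <-irrefl refl (begin-strict
  162 * Z            ≡⟨ *-assoc 81 2 Z ⟩
  81 * (2 * Z)       <⟨ *-monoʳ-< 81 near ⟩
  81 * (9 * (p * m)) ≡⟨ *-assoc 81 9 (p * m) ⟨
  729 * (p * m)      ≤⟨ bound-product {27} {7} (<⇒≤ (prime>1 pr)) (<⇒≤ 2≤m) bound-p bound-m ⟩
  147 * Z            ≤⟨ *-monoˡ-≤ Z (m≤m+n 147 15) ⟩
  162 * Z            ∎)
  where
  open ≤-Reasoning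
  Z = 3 ^ H₂ (p * m)
  bound-p : 27 * p ≤ 7 * 3 ^ H₂ p
  bound-p = 27*n≤7*3^H₂ p (prime>1 pr) (2∤n ∘ ∣m⇒∣m*n m) (3∤n ∘ ∣m⇒∣m*n m)
  bound-m : 27 * m ≤ 7 * 3 ^ H₂ m
  bound-m = 27*n≤7*3^H₂ m 2≤m (2∤n ∘ ∣n⇒∣m*n p) (3∤n ∘ ∣n⇒∣m*n p)

near-extremal-3* : ∀ {q} → 1 ≤ q → NearExtremal (3 * q) → NearExtremal q
near-extremal-3* {q} 1≤q near = *-cancelˡ-< 3 _ _ (begin-strict
  3 * (2 * 3 ^ H₂ q)    ≡⟨ *-CS.x∙yz≈y∙xz 3 2 (3 ^ H₂ q) ⟩
  2 * 3 ^ suc (H₂ q)    ≡⟨ cong (λ h → 2 * 3 ^ h) (H₂-3* 1≤q) ⟨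
  2 * 3 ^ H₂ (3 * q)    <⟨ near ⟩
  9 * (3 * q)           ≡⟨ *-CS.x∙yz≈y∙xz 9 3 q ⟩
  3 * (9 * q)           ∎)
  where open ≤-Reasoning

PowerOf3TimesPHat : ℕ → Set
PowerOf3TimesPHat m = ∃[ p ] ∃[ s ] (PHat p × m ≡ 3 ^ s * p)

PowerOf3TimesPHat-3* : ∀ {m q} → m ≡ 3 * q → PowerOf3TimesPHat q → PowerOf3TimesPHat m
PowerOf3TimesPHat-3* {m} {q} m≡3q (p , s , p̂ , q≡3^s*p) = p , suc s , p̂ , (begin
  m               ≡⟨ m≡3q ⟩
  3 * q           ≡⟨ cong (3 *_) q≡3^s*p ⟩
  3 * (3 ^ s * p) ≡⟨ *-assoc 3 (3 ^ s) p ⟨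
  3 ^ suc s * p   ∎)
  where open ≡-Reasoning

near-extremal-odd : ∀ m → 2 ≤ m → ¬ 2 ∣ m → NearExtremal m → PowerOf3TimesPHat m
near-extremal-odd = <-rec (λ m → 2 ≤ m → ¬ 2 ∣ m → NearExtremal m → PowerOf3TimesPHat m) step
  where
  step : ∀ m → (∀ {k} → k < m → 2 ≤ k → ¬ 2 ∣ k → NearExtremal k → PowerOf3TimesPHat k) →
         2 ≤ m → ¬ 2 ∣ m → NearExtremal m → PowerOf3TimesPHat m
  step m rec 2≤m 2∤m near with 3 ∣? m
  ... | yes 3∣m = multiple-of-3 (quotient 3∣m) (m∣n⇒n≡m*quotient 3∣m)
    where
    multiple-of-3 : ∀ q → m ≡ 3 * q → PowerOf3TimesPHat m
    multiple-of-3 zero m≡0 = contradiction (subst (2 ≤_) m≡0 2≤m) λ ()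
    multiple-of-3 (suc zero) m≡3 = 3 , 0 , PHat-3 , m≡3
    multiple-of-3 q@(suc (suc _)) m≡3q = PowerOf3TimesPHat-3* m≡3q (rec q<m (s≤s (s≤s z≤n))
      (λ 2∣q → 2∤m (subst (2 ∣_) (sym m≡3q) (∣n⇒∣m*n 3 2∣q)))
      (near-extremal-3* {q} (s≤s z≤n) (subst NearExtremal m≡3q near)))
      where
      q<m : q < m
      q<m = subst (q <_) (trans (*-comm q 3) (sym m≡3q)) (m<m*n q 3 (s≤s (s≤s z≤n)))
  ... | no 3∤m with primeOrProduct 2≤m
  ...   | isPrime pr = m , 0 , near-extremal-prime pr 2∤m near , sym (*-identityˡ m)
  ...   | isProduct pr 2≤q = contradiction near (near-extremal-composite pr 2≤q 2∤m 3∤m)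

PHat⇒odd : ∀ {p} → PHat p → ¬ 2 ∣ p
PHat⇒odd (_ , j , _ , refl) = subst (λ x → ¬ 2 ∣ x) (+-comm 1 (2 * 3 ^ (j ∸ 2))) (2∤1+2* (3 ^ (j ∸ 2)))

height-PHat : ∀ {p j} → Prime p → 2 ≤ j → p ≡ 2 * 3 ^ (j ∸ 2) + 1 → height p ≡ j
height-PHat {j = zero} _ () _
height-PHat {j = suc zero} _ (s≤s ()) _
height-PHat {j = suc (suc i)} pr _ refl = begin
  height (2 * 3 ^ i + 1)             ≡⟨ height-φ (prime>1 pr) ⟩
  suc (height (φ (2 * 3 ^ i + 1)))   ≡⟨ cong (suc ∘ height) (trans (φ-prime pr) (m+n∸n≡m (2 * 3 ^ i) 1)) ⟩
  suc (H₂ (3 ^ i))                   ≡⟨ cong suc (H₂-3^ i) ⟩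
  suc (suc i)                        ∎
  where open ≡-Reasoning

H₂-3^*odd : ∀ s {p} → 2 ≤ p → ¬ 2 ∣ p → H₂ (3 ^ s * p) ≡ s + height p
H₂-3^*odd s {p} 2≤p 2∤p = suc-injective (begin
  suc (H₂ (3 ^ s * p))   ≡⟨ H₂-additive (1≤3^ s) (<⇒≤ 2≤p) ⟩
  H₂ (3 ^ s) + H₂ p      ≡⟨ cong₂ _+_ (H₂-3^ s) (H₂-odd 2≤p 2∤p) ⟩
  suc s + height p       ∎)
  where open ≡-Reasoning

3*n≤3^height : ∀ {n} → 2 ≤ n → ¬ 2 ∣ n → 3 * n ≤ 3 ^ height n
3*n≤3^height {n} 2≤n 2∤n = subst (λ h → 3 * n ≤ 3 ^ h) (H₂-odd 2≤n 2∤n) (3*n≤3^H₂ n (<⇒≤ 2≤n))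

4*Y<2*m⇒2*[9*Y]<9*m : ∀ {Y m} → 4 * Y < 2 * m → 2 * (3 * (3 * Y)) < 9 * m
4*Y<2*m⇒2*[9*Y]<9*m {Y} {m} 4Y<2m = *-cancelˡ-< 2 _ _ (begin-strict
  2 * (2 * (3 * (3 * Y)))  ≡⟨ lhs Y ⟩
  9 * (4 * Y)              <⟨ *-monoʳ-< 9 4Y<2m ⟩
  9 * (2 * m)              ≡⟨ *-CS.x∙yz≈y∙xz 9 2 m ⟩
  2 * (9 * m)              ∎)
  where
  open ≤-Reasoning
  lhs : ∀ Y → 2 * (2 * (3 * (3 * Y))) ≡ 9 * (4 * Y)
  lhs = solve-∀

PowerOf3TimesPHat⇒witness : ∀ {k m} → H₂ m ≡ k → PowerOf3TimesPHat m →
  ∃[ p ] ∃[ a ] (PHat p × Height p a × a ≤ k × 2 * m ≡ 2 * 3 ^ (k ∸ a) * p)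
PowerOf3TimesPHat⇒witness {k} {m} H₂m≡k (p , s , p̂@(pr , _) , m≡3^s*p) =
  p , height p , p̂ , Height-height (<⇒≤ (prime>1 pr)) , subst (height p ≤_) (sym k≡s+a) (m≤n+m (height p) s) , (begin
    2 * m                       ≡⟨ cong (2 *_) m≡3^s*p ⟩
    2 * (3 ^ s * p)             ≡⟨ *-assoc 2 (3 ^ s) p ⟨
    2 * 3 ^ s * p               ≡⟨ cong (λ e → 2 * 3 ^ e * p) k∸a≡s ⟨
    2 * 3 ^ (k ∸ height p) * p  ∎)
  where
  open ≡-Reasoning
  k≡s+a : k ≡ s + height p
  k≡s+a = trans (sym H₂m≡k) (trans (cong H₂ m≡3^s*p) (H₂-3^*odd s (prime>1 pr) (PHat⇒odd p̂)))
  k∸a≡s : k ∸ height p ≡ s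
  k∸a≡s = trans (cong (_∸ height p) k≡s+a) (m+n∸n≡m s (height p))

R-member⇒form : ∀ i n → Height n (2 + i) → 4 * 3 ^ i < n →
  ∃[ p ] ∃[ a ] (PHat p × Height p a × a ≤ 2 + i × n ≡ 2 * 3 ^ (2 + i ∸ a) * p)
R-member⇒form i n h 4Y<n with parity n
... | odd t = contradiction (≤-trans n≤3Y (*-monoˡ-≤ Y (n≤1+n 3))) (<⇒≱ 4Y<n)
  where
  Y = 3 ^ i
  2≤n : 2 ≤ suc (2 * t)
  2≤n = ≤-trans (m≤m+n 2 2) (≤-trans (*-monoʳ-≤ 4 (1≤3^ i)) (<⇒≤ 4Y<n))
  n≤3Y : suc (2 * t) ≤ 3 * Y
  n≤3Y = *-cancelˡ-≤ 3 (subst (λ h → 3 * suc (2 * t) ≤ 3 ^ h) (Height⇒height≡ h) (3*n≤3^height 2≤n (2∤1+2* t)))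
... | even m with parity m
...   | even zero = contradiction 4Y<n λ ()
...   | even x@(suc _) = contradiction (*-monoʳ-≤ 2 (*-monoʳ-≤ 2 x≤Y)) (<⇒≱ (subst (_< 2 * (2 * x)) (*-assoc 2 2 Y) 4Y<n))
  where
  Y = 3 ^ i
  1≤x : 1 ≤ x
  1≤x = s≤s z≤n
  H₂x≡ : H₂ x ≡ suc i
  H₂x≡ = suc-injective (trans (sym (H₂-2* 1≤x)) (Height⇒height≡ h))
  x≤Y : x ≤ Y
  x≤Y = *-cancelˡ-≤ 3 (subst (λ h → 3 * x ≤ 3 ^ h) H₂x≡ (3*n≤3^H₂ x 1≤x))
...   | odd zero = contradiction (≤-trans (*-monoʳ-≤ 4 (1≤3^ i)) (<⇒≤ 4Y<n)) λ { (s≤s (s≤s ())) }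
...   | odd u@(suc _) = PowerOf3TimesPHat⇒witness (Height⇒height≡ h) (near-extremal-odd m 2≤m (2∤1+2* u) near)
  where
  2≤m : 2 ≤ m
  2≤m = s≤s (m≤m+n 1 _)
  near : NearExtremal m
  near = subst (λ h → 2 * 3 ^ h < 9 * m) (sym (Height⇒height≡ h)) (4*Y<2*m⇒2*[9*Y]<9*m {3 ^ i} {m} 4Y<n)

twice-PHat-multiple-bounds : ∀ {i j} → j ≤ i →
  4 * 3 ^ i < 2 * 3 ^ (i ∸ j) * (2 * 3 ^ j + 1) × 2 * 3 ^ (i ∸ j) * (2 * 3 ^ j + 1) ≤ 2 * 3 ^ suc i
twice-PHat-multiple-bounds {i} {j} j≤i = lower , upper
  where
  open ≤-Reasoning
  U = 3 ^ (i ∸ j)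
  w = 3 ^ j
  Uw≡3^i : U * w ≡ 3 ^ i
  Uw≡3^i = trans (sym (^-distribˡ-+-* 3 (i ∸ j) j)) (cong (3 ^_) (m∸n+n≡m j≤i))
  expand : ∀ U w → 2 * U * (2 * w + 1) ≡ 4 * (U * w) + 2 * U
  expand = solve-∀
  lower : 4 * 3 ^ i < 2 * U * (2 * w + 1)
  lower = begin-strict
    4 * 3 ^ i              ≡⟨ cong (4 *_) Uw≡3^i ⟨
    4 * (U * w)            <⟨ m<m+n (4 * (U * w)) (≤-trans (1≤3^ (i ∸ j)) (m≤m+n U _)) ⟩
    4 * (U * w) + 2 * U    ≡⟨ expand U w ⟨
    2 * U * (2 * w + 1)    ∎
  upper : 2 * U * (2 * w + 1) ≤ 2 * 3 ^ suc i
  upper = begin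
    2 * U * (2 * w + 1)        ≡⟨ expand U w ⟩
    4 * (U * w) + 2 * U        ≤⟨ +-monoʳ-≤ (4 * (U * w)) (*-monoʳ-≤ 2 (m≤m*n U w {{>-nonZero (1≤3^ j)}})) ⟩
    4 * (U * w) + 2 * (U * w)  ≡⟨ collect (U * w) ⟩
    2 * (3 * (U * w))          ≡⟨ cong (λ x → 2 * (3 * x)) Uw≡3^i ⟩
    2 * 3 ^ suc i              ∎
    where
    collect : ∀ x → 4 * x + 2 * x ≡ 2 * (3 * x)
    collect = solve-∀

form⇒R-member : ∀ i n → ∃[ p ] ∃[ a ] (PHat p × Height p a × a ≤ 2 + i × n ≡ 2 * 3 ^ (2 + i ∸ a) * p) →
  Height n (2 + i) × 4 * 3 ^ i < n × n ≤ 2 * 3 ^ suc i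
form⇒R-member i n (p , a , (pr , zero , () , _) , _)
form⇒R-member i n (p , a , (pr , suc zero , s≤s () , _) , _)
form⇒R-member i n (p , a , p̂@(pr , suc (suc j) , _ , refl) , hp , a≤k , n≡)
  with trans (sym (Height⇒height≡ hp)) (height-PHat {j = 2 + j} pr (s≤s (s≤s z≤n)) refl)
... | refl = height≡⇒Height (≤-trans (s≤s z≤n) lower) height-n≡k , lower , upper
  where
  open ≡-Reasoning
  s = 2 + i ∸ a
  bounds = twice-PHat-multiple-bounds (≤-pred (≤-pred a≤k))
  lower : 4 * 3 ^ i < n
  lower = subst (4 * 3 ^ i <_) (sym n≡) (proj₁ bounds)
  upper : n ≤ 2 * 3 ^ suc i
  upper = subst (_≤ 2 * 3 ^ suc i) (sym n≡) (proj₂ bounds)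
  height-n≡k : height n ≡ 2 + i
  height-n≡k = begin
    height n                 ≡⟨ cong height (trans n≡ (*-assoc 2 (3 ^ s) p)) ⟩
    H₂ (3 ^ s * p)           ≡⟨ H₂-3^*odd s (prime>1 pr) (PHat⇒odd p̂) ⟩
    s + height p             ≡⟨ cong (s +_) (Height⇒height≡ hp) ⟩
    s + a                    ≡⟨ m∸n+n≡m a≤k ⟩
    2 + i                    ∎

theorem3p3 : ∀ (k : ℕ) → 2 < k → ∀ (n : ℕ) →
      (Height n k × 4 * 3 ^ (k ∸ 2) < n × n ≤ 2 * 3 ^ (k ∸ 1))
      ⇔ (∃[ p ] ∃[ a ] (PHat p × Height p a × a ≤ k × n ≡ 2 * 3 ^ (k ∸ a) * p))
theorem3p3 zero () n
theorem3p3 (suc zero) (s≤s ()) n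
theorem3p3 (suc (suc i)) _ n = mk⇔ (λ (h , lower , _) → R-member⇒form i n h lower) (form⇒R-member i n)
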